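{- Consider an arbitrary recursive call of \textsc{RandomQueryPivot}$(p)$ (described in the context) with remaining vertex set $V_t$, and let $\{u,v\}\subseteq V_t$ be an edge on which $OPT$ makes a mistake. Then the probability that the algorithm queries $\{u,v\}$ in this call, conditioned on $u$ being the pivot, equals the probability that it queries $\{u,v\}$ in this call, conditioned on $v$ being the pivot.
   Context: Correlation clustering: the input is a complete graph $G=(V,E)$ in which every edge is labeled $+$ or $-$. A clustering is a partition of $V$; it makes a mistake on a $+$ edge whose endpoints are in different clusters and on a $-$ edge whose endpoints are in the same cluster. $OPT$ is a fixed optimal (minimum-mistake) clustering. The oracle answers a query on $\{u,v\}$ by saying whether $OPT$ makes a mistake on $\{u,v\}$. A $(+,+,-)$ triangle is a set of three vertices two of whose edges are $+$ and one is $-$. \textsc{RandomQueryPivot}$(p)$ on remaining vertex set $V$: if $V=\emptyset$ return the empty clustering. Otherwise choose a pivot $u$ uniformly at random from $V$. All edges $\{u,x\}$ start unmarked. For each $(+,+,-)$ triangle $\{u,v,w\}$ with $v,w\in V$, independently with probability $p$ do the following (with probability $1-p$ do nothing): (1) if $\{u,v\}$ and $\{u,w\}$ are both $+$, query both and mark each as a mistake iff $OPT$ makes a mistake on it; (2) if one of them is $+$ and the other $-$, query the $+$ edge and mark it if $OPT$ errs on it; if $OPT$ does not err on the $+$ edge, query the $-$ edge and mark it iff $OPT$ errs on it. Then let $C$ consist of $u$ and every $x\in V\setminus\{u\}$ with either ($\{u,x\}$ is $+$ and unmarked) or ($\{u,x\}$ is $-$ and marked). Return $\{C\}$ together with \textsc{RandomQueryPivot}$(p)$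 applied to $V\setminus C$. Each recursive call is an iteration. -}

module Defs where

open import Data.Bool using (Bool; true; false; if_then_else_; _∧_; _∨_; not)
open import Data.Nat as ℕ using (ℕ; zero; suc)
open import Data.Fin using (Fin; _<?_; _≟_)
open import Data.Fin.Subset using (Subset)
open import Data.Vec using (lookup)
open import Data.List using (List; []; _∷_; concatMap; filterᵇ; length; map; zipWith; foldr; _++_)
open import Data.List.Base using (allFin)
open import Data.Product using (_×_; _,_)
open import Data.Rational using (ℚ; 0ℚ; 1ℚ; _+_; _*_; _-_)
open import Relation.Nullary.Decidable using (⌊_⌋)
open import Data.Bool.ListAction using (or)

-- Signs of the complete graph on Fin n: true = '+' edge, false = '-' edge.
Sign : ℕ → Set
Sign n = Fin n → Fin n → Bool

-- A clustering (partition) of Fin n, given by a cluster label for each vertex.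
Clustering : ℕ → Set
Clustering n = Fin n → Fin n

eqᵇ : ∀ {n} → Fin n → Fin n → Bool
eqᵇ x y = ⌊ x ≟ y ⌋

ltᵇ : ∀ {n} → Fin n → Fin n → Bool
ltᵇ x y = ⌊ x <? y ⌋

mistake : ∀ {n} → Sign n → Clustering n → Fin n → Fin n → Bool
mistake s c x y = if s x y then not (eqᵇ (c x) (c y)) else eqᵇ (c x) (c y)

pairs : ∀ {n} → List (Fin n × Fin n)
pairs {n} = concatMap (λ x → map (λ y → (x , y)) (filterᵇ (ltᵇ x) (allFin n))) (allFin n)

cost : ∀ {n} → Sign n → Clustering n → ℕ
cost s c = length (filterᵇ (λ { (x , y) → mistake s c x y }) pairs)

Optimal : ∀ {n} → Sign n → Clustering n → Set
Optimal s c = ∀ c′ → cost s c ℕ.≤ cost s c′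

plusCount : ∀ {n} → Sign n → Fin n → Fin n → Fin n → ℕ
plusCount s a b d = cnt (s a b) ℕ.+ (cnt (s a d) ℕ.+ cnt (s b d))
  where
  cnt : Bool → ℕ
  cnt true = 1
  cnt false = 0

-- {a,b,d} is a (+,+,-) triangle (vertices distinctness handled by callers).
ppmᵇ : ∀ {n} → Sign n → Fin n → Fin n → Fin n → Bool
ppmᵇ s a b d = ⌊ plusCount s a b d ℕ.≟ 2 ⌋

triangles : ∀ {n} → Sign n → Subset n → Fin n → List (Fin n × Fin n)
triangles s V u =
  filterᵇ (λ { (a , b) → lookup V a ∧ lookup V b ∧ not (eqᵇ a u) ∧ not (eqᵇ b u) ∧ ppmᵇ s u a b })
          pairs

-- When the coin for triangle {u,a,b} (pivot u) succeeds, is the edge {u,x} queried?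
queries : ∀ {n} → Sign n → Clustering n → Fin n → Fin n × Fin n → Fin n → Bool
queries s c u (a , b) x =
  if s u a ∧ s u b then eqᵇ x a ∨ eqᵇ x b
  else if s u a then eqᵇ x a ∨ (eqᵇ x b ∧ not (mistake s c u a))
  else if s u b then eqᵇ x b ∨ (eqᵇ x a ∧ not (mistake s c u b))
  else false

outcomes : ℕ → List (List Bool)
outcomes zero = [] ∷ []
outcomes (suc k) = map (true ∷_) (outcomes k) ++ map (false ∷_) (outcomes k)

weight : ℚ → List Bool → ℚ
weight p [] = 1ℚ
weight p (true ∷ bs) = p * weight p bs
weight p (false ∷ bs) = (1ℚ - p) * weight p bs

-- Probability that, in the iteration on remaining set V with pivot u, the edge {u,x} is queried.
queryProb : ∀ {n} → Sign n → Clustering n → ℚ → Subset n → Fin n → Fin n → ℚ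
queryProb s c p V u x =
  foldr _+_ 0ℚ
    (map (λ bs → if or (zipWith (λ b t → b ∧ queries s c u t x) bs T) then weight p bs else 0ℚ)
         (outcomes (length T)))
  where
  T = triangles s V u

-- Both probabilities have the form 1 − (1 − p)^k, where k is the number of (+,+,−) triangles of
-- the iteration whose successful coin makes the pivot query {u,v}; so only these counts need to
-- be compared. A triangle drawn with pivot a can query {a,b} only if b is one of its vertices,
-- so both counts range over the third vertices w ∈ V ∖ {u,v} of (+,+,−) triangles {u,v,w}.
-- If {u,v} is +, it is queried from either pivot. If it is −, pivot u queries it iff OPT does
-- not err on the + edge {u,w}; since OPT errs on the − edge {u,v}, u and v share an OPT cluster,
-- so OPT errs on {u,w} iff it errs on {v,w}.
module Submission where

open import Defs
open import Algebra.Bundles using (CommutativeMonoid)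
open import Data.Bool using (Bool; true; false; if_then_else_; _∧_; _∨_; not)
open import Data.Bool.ListAction using (or)
open import Data.Bool.Properties using (∧-assoc; ∧-zeroʳ; ∨-identityʳ; ∧-commutativeMonoid)
open import Data.Fin using (Fin; _≟_; _<?_; _<_; punchIn)
open import Data.Fin.Properties using (<-cmp; <-irrefl; <⇒≢; punchInᵢ≢i)
open import Data.Fin.Subset using (Subset; _∈_)
open import Data.List
  using (List; []; _∷_; length; map; zipWith; foldr; _++_; filterᵇ; concatMap; tabulate; allFin)
open import Data.List.Properties using (map-++; map-∘; map-cong)
open import Data.Nat as ℕ using (ℕ; zero; suc)
import Data.Nat.Properties as ℕ
open import Data.Product using (_×_; _,_)
open import Data.Rational using (ℚ; 0ℚ; 1ℚ; _≤_; _+_; _*_; _-_; -_)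
open import Data.Rational.Properties
  using (+-identityˡ; +-identityʳ; +-assoc; +-comm; +-inverseʳ;
         *-zeroʳ; *-identityˡ; *-identityʳ; *-distribˡ-+; *-distribʳ-+)
open import Data.Vec using (lookup)
open import Data.Vec.Properties using ([]=⇒lookup)
open import Function using (_∘_; id)
open import Relation.Binary.Definitions using (tri<; tri≈; tri>)
open import Relation.Binary.PropositionalEquality
open import Relation.Nullary using (¬_; yes; no)
open import Relation.Nullary.Decidable using (dec-true; dec-false; isYes≗does; isYes)
open import Relation.Nullary.Negation using (contradiction)

open import Algebra.Properties.CommutativeMonoid.Sum ℕ.+-0-commutativeMonoid
  using (sum-syntax; sum-cong-≗; sum-remove; sum-replicate-zero; ∑-distrib-+; ∑-comm)
open import Algebra.Properties.CommutativeSemigroup ℕ.+-commutativeSemigroup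
  using () renaming (x∙yz≈y∙xz to +-left-comm)
open import Algebra.Properties.CommutativeSemigroup
  (CommutativeMonoid.commutativeSemigroup ∧-commutativeMonoid) using () renaming (x∙yz≈y∙xz to ∧-left-comm)

private variable
  A B : Set

sumℚ : List ℚ → ℚ
sumℚ = foldr _+_ 0ℚ

sumℚ-++ : ∀ xs ys → sumℚ (xs ++ ys) ≡ sumℚ xs + sumℚ ys
sumℚ-++ []       ys = sym (+-identityˡ _)
sumℚ-++ (x ∷ xs) ys = trans (cong (x +_) (sumℚ-++ xs ys)) (sym (+-assoc x _ _))

sumℚ-*ˡ : ∀ a (f : A → ℚ) xs → sumℚ (map (λ x → a * f x) xs) ≡ a * sumℚ (map f xs)
sumℚ-*ˡ a f []       = sym (*-zeroʳ a)
sumℚ-*ˡ a f (x ∷ xs) = trans (cong (a * f x +_) (sumℚ-*ˡ a f xs)) (sym (*-distribˡ-+ a _ _))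

p+[1-p]≡1 : ∀ p → p + (1ℚ - p) ≡ 1ℚ
p+[1-p]≡1 p = begin
  p + (1ℚ + - p)  ≡⟨ cong (p +_) (+-comm 1ℚ (- p)) ⟩
  p + (- p + 1ℚ)  ≡⟨ +-assoc p (- p) 1ℚ ⟨
  p + - p + 1ℚ    ≡⟨ cong (_+ 1ℚ) (+-inverseʳ p) ⟩
  0ℚ + 1ℚ         ≡⟨ +-identityˡ 1ℚ ⟩
  1ℚ              ∎
  where open ≡-Reasoning

sumℚ-outcomes-suc : ∀ (f : List Bool → ℚ) k →
  sumℚ (map f (outcomes (suc k))) ≡
  sumℚ (map (f ∘ (true ∷_)) (outcomes k)) + sumℚ (map (f ∘ (false ∷_)) (outcomes k))
sumℚ-outcomes-suc f k = begin
  sumℚ (map f (map (true ∷_) O ++ map (false ∷_) O))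
    ≡⟨ cong sumℚ (map-++ f (map (true ∷_) O) _) ⟩
  sumℚ (map f (map (true ∷_) O) ++ map f (map (false ∷_) O))
    ≡⟨ sumℚ-++ (map f (map (true ∷_) O)) _ ⟩
  sumℚ (map f (map (true ∷_) O)) + sumℚ (map f (map (false ∷_) O))
    ≡⟨ cong₂ _+_ (cong sumℚ (map-∘ O)) (cong sumℚ (map-∘ O)) ⟨
  sumℚ (map (f ∘ (true ∷_)) O) + sumℚ (map (f ∘ (false ∷_)) O) ∎
  where open ≡-Reasoning
        O = outcomes k

sumℚ-weight-outcomes : ∀ p k → sumℚ (map (weight p) (outcomes k)) ≡ 1ℚ
sumℚ-weight-outcomes p zero    = +-identityʳ 1ℚ
sumℚ-weight-outcomes p (suc k) = begin
  sumℚ (map (weight p) (outcomes (suc k)))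
    ≡⟨ sumℚ-outcomes-suc (weight p) k ⟩
  sumℚ (map (λ bs → p * weight p bs) O) + sumℚ (map (λ bs → (1ℚ - p) * weight p bs) O)
    ≡⟨ cong₂ _+_ (sumℚ-*ˡ p (weight p) O) (sumℚ-*ˡ (1ℚ - p) (weight p) O) ⟩
  p * sumℚ (map (weight p) O) + (1ℚ - p) * sumℚ (map (weight p) O)
    ≡⟨ *-distribʳ-+ _ p (1ℚ - p) ⟨
  (p + (1ℚ - p)) * sumℚ (map (weight p) O)
    ≡⟨ cong₂ _*_ (p+[1-p]≡1 p) (sumℚ-weight-outcomes p k) ⟩
  1ℚ * 1ℚ
    ≡⟨ *-identityʳ 1ℚ ⟩
  1ℚ ∎
  where open ≡-Reasoning
        O = outcomes k

atLeastOneSuccess : ℚ → ℕ → ℚ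
atLeastOneSuccess p zero    = 0ℚ
atLeastOneSuccess p (suc k) = p + (1ℚ - p) * atLeastOneSuccess p k

countᵇ : (A → Bool) → List A → ℕ
countᵇ m xs = length (filterᵇ m xs)

module _ (p : ℚ) (m : A → Bool) where

  hitWeight : List A → List Bool → ℚ
  hitWeight T bs = if or (zipWith (λ b t → b ∧ m t) bs T) then weight p bs else 0ℚ

  hitProb : List A → ℚ
  hitProb T = sumℚ (map (hitWeight T) (outcomes (length T)))

  private
    if-*ˡ : ∀ a w (b : Bool) → (if b then a * w else 0ℚ) ≡ a * (if b then w else 0ℚ)
    if-*ˡ a w true  = refl
    if-*ˡ a w false = sym (*-zeroʳ a)

  hitWeight-true : ∀ t T bs →
    hitWeight (t ∷ T) (true ∷ bs) ≡ p * (if m t then weight p bs else hitWeight T bs)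
  hitWeight-true t T bs with m t
  ... | true  = refl
  ... | false = if-*ˡ p (weight p bs) _

  hitWeight-false : ∀ t T bs → hitWeight (t ∷ T) (false ∷ bs) ≡ (1ℚ - p) * hitWeight T bs
  hitWeight-false t T bs = if-*ˡ (1ℚ - p) (weight p bs) _

  hitProb-∷ : ∀ t T →
    hitProb (t ∷ T) ≡ p * (if m t then 1ℚ else hitProb T) + (1ℚ - p) * hitProb T
  hitProb-∷ t T = begin
    hitProb (t ∷ T)
      ≡⟨ sumℚ-outcomes-suc (hitWeight (t ∷ T)) (length T) ⟩
    sumℚ (map (hitWeight (t ∷ T) ∘ (true ∷_)) O) + sumℚ (map (hitWeight (t ∷ T) ∘ (false ∷_)) O)
      ≡⟨ cong₂ _+_ (cong sumℚ (map-cong (hitWeight-true t T) O))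
                   (cong sumℚ (map-cong (hitWeight-false t T) O)) ⟩
    sumℚ (map (λ bs → p * (if m t then weight p bs else hitWeight T bs)) O)
      + sumℚ (map (λ bs → (1ℚ - p) * hitWeight T bs) O)
      ≡⟨ cong₂ _+_ (sumℚ-*ˡ p _ O) (sumℚ-*ˡ (1ℚ - p) (hitWeight T) O) ⟩
    p * sumℚ (map (λ bs → if m t then weight p bs else hitWeight T bs) O) + (1ℚ - p) * hitProb T
      ≡⟨ cong (λ x → p * x + (1ℚ - p) * hitProb T) (selected (m t)) ⟩
    p * (if m t then 1ℚ else hitProb T) + (1ℚ - p) * hitProb T ∎
    where
    open ≡-Reasoning
    O = outcomes (length T)
    selected : ∀ b →
      sumℚ (map (λ bs → if b then weight p bs else hitWeight T bs) O) ≡ (if b then 1ℚ else hitProb T)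
    selected true  = sumℚ-weight-outcomes p (length T)
    selected false = refl

  hitProb≡atLeastOneSuccess : ∀ T → hitProb T ≡ atLeastOneSuccess p (countᵇ m T)
  hitProb≡atLeastOneSuccess []      = +-identityʳ 0ℚ
  hitProb≡atLeastOneSuccess (t ∷ T) with m t | hitProb-∷ t T
  ... | true  | hitProb-t∷T = trans hitProb-t∷T
    (cong₂ _+_ (*-identityʳ p) (cong ((1ℚ - p) *_) (hitProb≡atLeastOneSuccess T)))
  ... | false | hitProb-t∷T = begin
    hitProb (t ∷ T)                           ≡⟨ hitProb-t∷T ⟩
    p * hitProb T + (1ℚ - p) * hitProb T      ≡⟨ *-distribʳ-+ (hitProb T) p (1ℚ - p) ⟨
    (p + (1ℚ - p)) * hitProb T                ≡⟨ cong₂ _*_ (p+[1-p]≡1 p) (hitProb≡atLeastOneSuccess T) ⟩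
    1ℚ * atLeastOneSuccess p (countᵇ m T)     ≡⟨ *-identityˡ _ ⟩
    atLeastOneSuccess p (countᵇ m T)          ∎
    where open ≡-Reasoning

𝟙 : Bool → ℕ
𝟙 true  = 1
𝟙 false = 0

countᵇ-∷ : ∀ (m : A → Bool) x xs → countᵇ m (x ∷ xs) ≡ 𝟙 (m x) ℕ.+ countᵇ m xs
countᵇ-∷ m x xs with m x
... | true  = refl
... | false = refl

countᵇ-++ : ∀ (m : A → Bool) xs ys → countᵇ m (xs ++ ys) ≡ countᵇ m xs ℕ.+ countᵇ m ys
countᵇ-++ m []       ys = refl
countᵇ-++ m (x ∷ xs) ys = begin
  countᵇ m (x ∷ xs ++ ys)                          ≡⟨ countᵇ-∷ m x (xs ++ ys) ⟩
  𝟙 (m x) ℕ.+ countᵇ m (xs ++ ys)                  ≡⟨ cong (𝟙 (m x) ℕ.+_) (countᵇ-++ m xs ys) ⟩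
  𝟙 (m x) ℕ.+ (countᵇ m xs ℕ.+ countᵇ m ys)        ≡⟨ ℕ.+-assoc (𝟙 (m x)) _ _ ⟨
  𝟙 (m x) ℕ.+ countᵇ m xs ℕ.+ countᵇ m ys          ≡⟨ cong (ℕ._+ countᵇ m ys) (countᵇ-∷ m x xs) ⟨
  countᵇ m (x ∷ xs) ℕ.+ countᵇ m ys                ∎
  where open ≡-Reasoning

countᵇ-filterᵇ : ∀ (m q : A → Bool) xs → countᵇ m (filterᵇ q xs) ≡ countᵇ (λ x → q x ∧ m x) xs
countᵇ-filterᵇ m q []       = refl
countᵇ-filterᵇ m q (x ∷ xs) with q x
... | false = countᵇ-filterᵇ m q xs
... | true with m x
...   | true  = cong suc (countᵇ-filterᵇ m q xs)
...   | false = countᵇ-filterᵇ m q xs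

countᵇ-map : ∀ (m : B → Bool) (f : A → B) xs → countᵇ m (map f xs) ≡ countᵇ (m ∘ f) xs
countᵇ-map m f []       = refl
countᵇ-map m f (x ∷ xs) = trans (countᵇ-∷ m (f x) (map f xs))
  (trans (cong (𝟙 (m (f x)) ℕ.+_) (countᵇ-map m f xs)) (sym (countᵇ-∷ (m ∘ f) x xs)))

countᵇ-tabulate : ∀ {n} (m : A → Bool) (f : Fin n → A) → countᵇ m (tabulate f) ≡ ∑[ i < n ] 𝟙 (m (f i))
countᵇ-tabulate {n = zero}  m f = refl
countᵇ-tabulate {n = suc n} m f = trans (countᵇ-∷ m (f Fin.zero) (tabulate (f ∘ Fin.suc)))
  (cong (𝟙 (m (f Fin.zero)) ℕ.+_) (countᵇ-tabulate m (f ∘ Fin.suc)))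

countᵇ-concatMap-tabulate : ∀ {n} (m : B → Bool) (g : A → List B) (f : Fin n → A) →
  countᵇ m (concatMap g (tabulate f)) ≡ ∑[ i < n ] countᵇ m (g (f i))
countᵇ-concatMap-tabulate {n = zero}  m g f = refl
countᵇ-concatMap-tabulate {n = suc n} m g f =
  trans (countᵇ-++ m (g (f Fin.zero)) (concatMap g (tabulate (f ∘ Fin.suc))))
    (cong (countᵇ m (g (f Fin.zero)) ℕ.+_) (countᵇ-concatMap-tabulate m g (f ∘ Fin.suc)))

countᵇ-pairs : ∀ {n} (P : Fin n × Fin n → Bool) →
  countᵇ P (pairs {n}) ≡ ∑[ x < n ] ∑[ y < n ] 𝟙 (ltᵇ x y ∧ P (x , y))
countᵇ-pairs {n} P =
  trans (countᵇ-concatMap-tabulate P (λ x → map (x ,_) (filterᵇ (ltᵇ x) (allFin n))) id)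
        (sum-cong-≗ row)
  where
  open ≡-Reasoning
  row : ∀ x → countᵇ P (map (x ,_) (filterᵇ (ltᵇ x) (allFin n))) ≡ ∑[ y < n ] 𝟙 (ltᵇ x y ∧ P (x , y))
  row x = begin
    countᵇ P (map (x ,_) (filterᵇ (ltᵇ x) (allFin n)))
      ≡⟨ countᵇ-map P (x ,_) (filterᵇ (ltᵇ x) (allFin n)) ⟩
    countᵇ (λ y → P (x , y)) (filterᵇ (ltᵇ x) (allFin n))
      ≡⟨ countᵇ-filterᵇ (λ y → P (x , y)) (ltᵇ x) (allFin n) ⟩
    countᵇ (λ y → ltᵇ x y ∧ P (x , y)) (allFin n)
      ≡⟨ countᵇ-tabulate (λ y → ltᵇ x y ∧ P (x , y)) id ⟩
    ∑[ y < n ] 𝟙 (ltᵇ x y ∧ P (x , y)) ∎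

module _ {n : ℕ} where

  eqᵇ-refl : (x : Fin n) → eqᵇ x x ≡ true
  eqᵇ-refl x = trans (isYes≗does (x ≟ x)) (dec-true (x ≟ x) refl)

  eqᵇ-≢ : {x y : Fin n} → x ≢ y → eqᵇ x y ≡ false
  eqᵇ-≢ {x} {y} x≢y = trans (isYes≗does (x ≟ y)) (dec-false (x ≟ y) x≢y)

  eqᵇ⇒≡ : {x y : Fin n} → eqᵇ x y ≡ true → x ≡ y
  eqᵇ⇒≡ {x} {y} eq with x ≟ y
  ... | yes x≡y = x≡y

  ltᵇ-< : {x y : Fin n} → x < y → ltᵇ x y ≡ true
  ltᵇ-< {x} {y} x<y = trans (isYes≗does (x <? y)) (dec-true (x <? y) x<y)

  ltᵇ-≮ : {x y : Fin n} → ¬ x < y → ltᵇ x y ≡ false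
  ltᵇ-≮ {x} {y} x≮y = trans (isYes≗does (x <? y)) (dec-false (x <? y) x≮y)

  ltᵇ⇒≢ : {x y : Fin n} → ltᵇ x y ≡ true → x ≢ y
  ltᵇ⇒≢ {x} {y} lt with x <? y
  ... | yes x<y = <⇒≢ x<y

∑-𝟙-at : ∀ {n} (b : Fin n) (P : Fin n → Bool) → ∑[ x < n ] 𝟙 (eqᵇ x b ∧ P x) ≡ 𝟙 (P b)
∑-𝟙-at {suc n} b P = begin
  ∑[ x < suc n ] f x                      ≡⟨ sum-remove {i = b} f ⟩
  f b ℕ.+ ∑[ j < n ] f (punchIn b j)
    ≡⟨ cong₂ ℕ._+_ (cong (λ e → 𝟙 (e ∧ P b)) (eqᵇ-refl b)) (sum-cong-≗ f-punchIn) ⟩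
  𝟙 (P b) ℕ.+ ∑[ j < n ] 0                ≡⟨ cong (𝟙 (P b) ℕ.+_) (sum-replicate-zero n) ⟩
  𝟙 (P b) ℕ.+ 0                           ≡⟨ ℕ.+-identityʳ _ ⟩
  𝟙 (P b)                                 ∎
  where
  open ≡-Reasoning
  f : Fin (suc n) → ℕ
  f x = 𝟙 (eqᵇ x b ∧ P x)
  f-punchIn : ∀ j → f (punchIn b j) ≡ 0
  f-punchIn j rewrite eqᵇ-≢ (punchInᵢ≢i b j) = refl

module _ {n : ℕ} (b : Fin n) (h : Fin n → Bool) where

  𝟙-pair-through : ∀ x y → 𝟙 (ltᵇ x y ∧ ((eqᵇ x b ∧ h y) ∨ (eqᵇ y b ∧ h x))) ≡
                           𝟙 (eqᵇ x b ∧ (ltᵇ b y ∧ h y)) ℕ.+ 𝟙 (eqᵇ y b ∧ (ltᵇ x b ∧ h x))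
  𝟙-pair-through x y with x ≟ b | y ≟ b
  ... | yes refl | yes refl rewrite ltᵇ-≮ (<-irrefl {x = b} refl) = refl
  ... | yes refl | no y≢b rewrite ∨-identityʳ (h y) = sym (ℕ.+-identityʳ _)
  ... | no x≢b | yes refl = refl
  ... | no x≢b | no y≢b rewrite ∧-zeroʳ (ltᵇ x y) = refl

  𝟙-split-at : h b ≡ false → ∀ w → 𝟙 (ltᵇ b w ∧ h w) ℕ.+ 𝟙 (ltᵇ w b ∧ h w) ≡ 𝟙 (h w)
  𝟙-split-at hb w with <-cmp b w
  ... | tri< b<w _ w≮b rewrite ltᵇ-< b<w | ltᵇ-≮ w≮b = ℕ.+-identityʳ _
  ... | tri≈ _ refl _  rewrite hb | ∧-zeroʳ (ltᵇ b b) = refl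
  ... | tri> b≮w _ w<b rewrite ltᵇ-≮ b≮w | ltᵇ-< w<b = refl

  ∑-pairs-through : h b ≡ false →
    ∑[ x < n ] ∑[ y < n ] 𝟙 (ltᵇ x y ∧ ((eqᵇ x b ∧ h y) ∨ (eqᵇ y b ∧ h x))) ≡ ∑[ w < n ] 𝟙 (h w)
  ∑-pairs-through hb = begin
    ∑[ x < n ] ∑[ y < n ] 𝟙 (ltᵇ x y ∧ ((eqᵇ x b ∧ h y) ∨ (eqᵇ y b ∧ h x)))
      ≡⟨ sum-cong-≗ (λ x → trans (sum-cong-≗ (𝟙-pair-through x)) (∑-distrib-+ (L x) (R x))) ⟩
    ∑[ x < n ] (∑[ y < n ] L x y ℕ.+ ∑[ y < n ] R x y)
      ≡⟨ ∑-distrib-+ (λ x → ∑[ y < n ] L x y) (λ x → ∑[ y < n ] R x y) ⟩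
    ∑[ x < n ] ∑[ y < n ] L x y ℕ.+ ∑[ x < n ] ∑[ y < n ] R x y
      ≡⟨ cong (ℕ._+ ∑[ x < n ] ∑[ y < n ] R x y) (∑-comm L) ⟩
    ∑[ y < n ] ∑[ x < n ] L x y ℕ.+ ∑[ x < n ] ∑[ y < n ] R x y
      ≡⟨ cong₂ ℕ._+_ (sum-cong-≗ (λ y → ∑-𝟙-at b (λ _ → ltᵇ b y ∧ h y)))
                      (sum-cong-≗ (λ x → ∑-𝟙-at b (λ _ → ltᵇ x b ∧ h x))) ⟩
    ∑[ w < n ] 𝟙 (ltᵇ b w ∧ h w) ℕ.+ ∑[ w < n ] 𝟙 (ltᵇ w b ∧ h w)
      ≡⟨ ∑-distrib-+ (λ w → 𝟙 (ltᵇ b w ∧ h w)) (λ w → 𝟙 (ltᵇ w b ∧ h w)) ⟨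
    ∑[ w < n ] (𝟙 (ltᵇ b w ∧ h w) ℕ.+ 𝟙 (ltᵇ w b ∧ h w))
      ≡⟨ sum-cong-≗ (𝟙-split-at hb) ⟩
    ∑[ w < n ] 𝟙 (h w) ∎
    where
    open ≡-Reasoning
    L R : Fin n → Fin n → ℕ
    L x y = 𝟙 (eqᵇ x b ∧ (ltᵇ b y ∧ h y))
    R x y = 𝟙 (eqᵇ y b ∧ (ltᵇ x b ∧ h x))

∧-reassoc : ∀ x y z w → (x ∧ (y ∧ z)) ∧ w ≡ x ∧ (y ∧ (z ∧ w))
∧-reassoc x y z w = trans (∧-assoc x (y ∧ z) w) (cong (x ∧_) (∧-assoc y z w))

plusCount-𝟙 : ∀ {n} (s : Sign n) a b d → plusCount s a b d ≡ 𝟙 (s a b) ℕ.+ (𝟙 (s a d) ℕ.+ 𝟙 (s b d))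
plusCount-𝟙 s a b d with s a b | s a d | s b d
... | true  | true  | true  = refl
... | true  | true  | false = refl
... | true  | false | true  = refl
... | true  | false | false = refl
... | false | true  | true  = refl
... | false | true  | false = refl
... | false | false | true  = refl
... | false | false | false = refl

-- Definitionally the filter predicate of `triangles s V a`.
isTriangle : ∀ {n} → Sign n → Subset n → Fin n → Fin n × Fin n → Bool
isTriangle s V a (x , y) = lookup V x ∧ lookup V y ∧ not (eqᵇ x a) ∧ not (eqᵇ y a) ∧ ppmᵇ s a x y

module _ {n : ℕ} (s : Sign n) (c : Clustering n) where

  -- For a (+,+,−) triangle {a,b,w} with pivot a: a + edge {a,b} is always queried; a − edge
  -- {a,b} is queried after the + edge {a,w} only if OPT does not err on {a,w}.
  queriesVia : Fin n → Fin n → Fin n → Bool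
  queriesVia a b w = if s a b then true else (s a w ∧ not (mistake s c a w))

  queries-fst : ∀ a {b w} → b ≢ w → queries s c a (b , w) b ≡ queriesVia a b w
  queries-fst a {b} {w} b≢w rewrite eqᵇ-refl b | eqᵇ-≢ b≢w with s a b | s a w
  ... | true  | true  = refl
  ... | true  | false = refl
  ... | false | true  = refl
  ... | false | false = refl

  queries-snd : ∀ a {b w} → b ≢ w → queries s c a (w , b) b ≡ queriesVia a b w
  queries-snd a {b} {w} b≢w rewrite eqᵇ-refl b | eqᵇ-≢ b≢w with s a b | s a w
  ... | true  | true  = refl
  ... | true  | false = refl
  ... | false | true  = refl
  ... | false | false = refl

  queries-other : ∀ a {b x y} → b ≢ x → b ≢ y → queries s c a (x , y) b ≡ false
  queries-other a {b} {x} {y} b≢x b≢y rewrite eqᵇ-≢ b≢x | eqᵇ-≢ b≢y with s a x | s a y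
  ... | true  | true  = refl
  ... | true  | false = refl
  ... | false | true  = refl
  ... | false | false = refl

  module _ (V : Subset n) where

    queryingThird : Fin n → Fin n → Fin n → Bool
    queryingThird a b w = lookup V w ∧ not (eqᵇ w a) ∧ not (eqᵇ w b) ∧ ppmᵇ s a b w ∧ queriesVia a b w

    queryingThird-self : ∀ a b → queryingThird a b b ≡ false
    queryingThird-self a b rewrite eqᵇ-refl b | ∧-zeroʳ (not (eqᵇ b a)) = ∧-zeroʳ (lookup V b)

module _ {n : ℕ} (s : Sign n) (s-sym : ∀ x y → s x y ≡ s y x) where

  ppmᵇ-swapˡ : ∀ a b d → ppmᵇ s a b d ≡ ppmᵇ s b a d
  ppmᵇ-swapˡ a b d = cong (λ k → isYes (k ℕ.≟ 2)) (begin
    plusCount s a b d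
      ≡⟨ plusCount-𝟙 s a b d ⟩
    𝟙 (s a b) ℕ.+ (𝟙 (s a d) ℕ.+ 𝟙 (s b d))
      ≡⟨ cong₂ ℕ._+_ (cong 𝟙 (s-sym a b)) (ℕ.+-comm (𝟙 (s a d)) _) ⟩
    𝟙 (s b a) ℕ.+ (𝟙 (s b d) ℕ.+ 𝟙 (s a d))
      ≡⟨ plusCount-𝟙 s b a d ⟨
    plusCount s b a d ∎)
    where open ≡-Reasoning

  ppmᵇ-swapʳ : ∀ a b d → ppmᵇ s a b d ≡ ppmᵇ s a d b
  ppmᵇ-swapʳ a b d = cong (λ k → isYes (k ℕ.≟ 2)) (begin
    plusCount s a b d
      ≡⟨ plusCount-𝟙 s a b d ⟩
    𝟙 (s a b) ℕ.+ (𝟙 (s a d) ℕ.+ 𝟙 (s b d))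
      ≡⟨ +-left-comm (𝟙 (s a b)) (𝟙 (s a d)) (𝟙 (s b d)) ⟩
    𝟙 (s a d) ℕ.+ (𝟙 (s a b) ℕ.+ 𝟙 (s b d))
      ≡⟨ cong (λ σ → 𝟙 (s a d) ℕ.+ (𝟙 (s a b) ℕ.+ 𝟙 σ)) (s-sym b d) ⟩
    𝟙 (s a d) ℕ.+ (𝟙 (s a b) ℕ.+ 𝟙 (s d b))
      ≡⟨ plusCount-𝟙 s a d b ⟨
    plusCount s a d b ∎)
    where open ≡-Reasoning

  module _ (c : Clustering n) where

    queriesVia-sym : ∀ {u v} → mistake s c u v ≡ true →
      ∀ w → ppmᵇ s u v w ∧ queriesVia s c u v w ≡ ppmᵇ s v u w ∧ queriesVia s c v u w
    queriesVia-sym {u} {v} err w rewrite ppmᵇ-swapˡ v u w | s-sym v u with s u v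
    ... | true = refl
    ... | false with s u w | s v w
    -- Here err has become c u ≟ c v: OPT errs on the − edge {u,v}, so u and v share a cluster.
    ...   | true  | true  rewrite eqᵇ⇒≡ err = refl
    ...   | true  | false = refl
    ...   | false | true  = refl
    ...   | false | false = refl

    module _ (V : Subset n) where

      triangle-queries : ∀ {a b} → lookup V b ≡ true → b ≢ a → ∀ {x y} → x ≢ y →
        isTriangle s V a (x , y) ∧ queries s c a (x , y) b
          ≡ (eqᵇ x b ∧ queryingThird s c V a b y) ∨ (eqᵇ y b ∧ queryingThird s c V a b x)
      triangle-queries {a} {b} Vb b≢a {x} {y} x≢y with x ≟ b | y ≟ b
      ... | yes refl | yes refl = contradiction refl x≢y
      ... | yes refl | no y≢b
        rewrite Vb | eqᵇ-≢ b≢a | queries-fst s c a (≢-sym y≢b) =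
          trans (∧-reassoc (lookup V y) (not (eqᵇ y a)) (ppmᵇ s a b y) (queriesVia s c a b y))
                (sym (∨-identityʳ _))
      ... | no x≢b | yes refl
        rewrite Vb | eqᵇ-≢ b≢a | queries-snd s c a (≢-sym x≢b) | ppmᵇ-swapʳ a x b =
          ∧-reassoc (lookup V x) (not (eqᵇ x a)) (ppmᵇ s a b x) (queriesVia s c a b x)
      ... | no x≢b | no y≢b rewrite queries-other s c a (≢-sym x≢b) (≢-sym y≢b) = ∧-zeroʳ _

      count-queries : ∀ {a b} → lookup V b ≡ true → b ≢ a →
        countᵇ (λ t → queries s c a t b) (triangles s V a) ≡ ∑[ w < n ] 𝟙 (queryingThird s c V a b w)
      count-queries {a} {b} Vb b≢a = begin
        countᵇ (λ t → queries s c a t b) (triangles s V a)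
          ≡⟨ countᵇ-filterᵇ (λ t → queries s c a t b) (isTriangle s V a) pairs ⟩
        countᵇ (λ t → isTriangle s V a t ∧ queries s c a t b) pairs
          ≡⟨ countᵇ-pairs (λ t → isTriangle s V a t ∧ queries s c a t b) ⟩
        ∑[ x < n ] ∑[ y < n ] 𝟙 (ltᵇ x y ∧ (isTriangle s V a (x , y) ∧ queries s c a (x , y) b))
          ≡⟨ sum-cong-≗ (λ x → sum-cong-≗ (λ y → cong 𝟙 (on-pair x y))) ⟩
        ∑[ x < n ] ∑[ y < n ]
          𝟙 (ltᵇ x y ∧ ((eqᵇ x b ∧ queryingThird s c V a b y) ∨ (eqᵇ y b ∧ queryingThird s c V a b x)))
          ≡⟨ ∑-pairs-through b (queryingThird s c V a b) (queryingThird-self s c V a b) ⟩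
        ∑[ w < n ] 𝟙 (queryingThird s c V a b w) ∎
        where
        open ≡-Reasoning
        on-pair : ∀ x y →
          ltᵇ x y ∧ (isTriangle s V a (x , y) ∧ queries s c a (x , y) b)
            ≡ ltᵇ x y ∧ ((eqᵇ x b ∧ queryingThird s c V a b y) ∨ (eqᵇ y b ∧ queryingThird s c V a b x))
        on-pair x y with ltᵇ x y in x<y
        ... | true  = triangle-queries Vb b≢a (ltᵇ⇒≢ x<y)
        ... | false = refl

      queryingThird-sym : ∀ {u v} → mistake s c u v ≡ true →
        ∀ w → queryingThird s c V u v w ≡ queryingThird s c V v u w
      queryingThird-sym {u} {v} err w = cong (lookup V w ∧_) (begin
        not (eqᵇ w u) ∧ not (eqᵇ w v) ∧ ppmᵇ s u v w ∧ queriesVia s c u v w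
          ≡⟨ cong (λ q → not (eqᵇ w u) ∧ not (eqᵇ w v) ∧ q) (queriesVia-sym err w) ⟩
        not (eqᵇ w u) ∧ not (eqᵇ w v) ∧ ppmᵇ s v u w ∧ queriesVia s c v u w
          ≡⟨ ∧-left-comm (not (eqᵇ w u)) (not (eqᵇ w v)) _ ⟩
        not (eqᵇ w v) ∧ not (eqᵇ w u) ∧ ppmᵇ s v u w ∧ queriesVia s c v u w ∎)
        where open ≡-Reasoning

lemma6 : ∀ {n} (s : Sign n) → (∀ x y → s x y ≡ s y x) →
         (c : Clustering n) → Optimal s c →
         (p : ℚ) → 0ℚ ≤ p → p ≤ 1ℚ →
         (V : Subset n) (u v : Fin n) → u ≢ v → u ∈ V → v ∈ V →
         mistake s c u v ≡ true →
         queryProb s c p V u v ≡ queryProb s c p V v u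
lemma6 {n} s s-sym c _ p _ _ V u v u≢v u∈V v∈V err = begin
  queryProb s c p V u v
    ≡⟨ hitProb≡atLeastOneSuccess p (λ t → queries s c u t v) (triangles s V u) ⟩
  atLeastOneSuccess p (countᵇ (λ t → queries s c u t v) (triangles s V u))
    ≡⟨ cong (atLeastOneSuccess p) counts-agree ⟩
  atLeastOneSuccess p (countᵇ (λ t → queries s c v t u) (triangles s V v))
    ≡⟨ hitProb≡atLeastOneSuccess p (λ t → queries s c v t u) (triangles s V v) ⟨
  queryProb s c p V v u ∎
  where
  open ≡-Reasoning
  counts-agree : countᵇ (λ t → queries s c u t v) (triangles s V u)
               ≡ countᵇ (λ t → queries s c v t u) (triangles s V v)
  counts-agree = begin
    countᵇ (λ t → queries s c u t v) (triangles s V u)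
      ≡⟨ count-queries s s-sym c V ([]=⇒lookup v∈V) (≢-sym u≢v) ⟩
    ∑[ w < n ] 𝟙 (queryingThird s c V u v w)
      ≡⟨ sum-cong-≗ (cong 𝟙 ∘ queryingThird-sym s s-sym c V err) ⟩
    ∑[ w < n ] 𝟙 (queryingThird s c V v u w)
      ≡⟨ count-queries s s-sym c V ([]=⇒lookup u∈V) u≢v ⟨
    countᵇ (λ t → queries s c v t u) (triangles s V v) ∎
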